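{- For every integer $k\ge1$, the $k$-phase ranking function template, written in conjunctive normal form with the conjuncts $\delta_i>0$ ($i=1,\ldots,k$), $\ \bigvee_{i=1}^k f_i(x)>0$, and $\ f_i(x')<f_i(x)-\delta_i\vee\bigvee_{j=1}^{i-1}f_j(x)>0$ ($i=1,\ldots,k$), over function symbols $F=\{f_1,\ldots,f_k\}$ and variables $D=\{\delta_1,\ldots,\delta_k\}$, has degree $\frac12k(k-1)$.
   Context: Each atom has the form $\sum_{f\in F}(\alpha_f f(x)+\beta_f f(x'))+\sum_{d\in D}\gamma_d d\rhd0$ ($\rhd\in\{\ge,>\}$); a symbol or variable occurs in an atom iff its coefficient there is nonzero. Atom occurrences in the CNF are distinguished even if the same atom occurs in several places. The dependency graph $G_T$ of a template $T$ has node set $D\cup F$ and an undirected edge between $u,v$ (including $u=v$) iff some atom of $T$ contains both; $[u]$ is the connected component of $u$. A coloring $\eta$ maps each atom occurrence to one of white (uncolored), red, blue. The coloring graph $G_\eta$ is the directed graph on the connected components of $G_T$ with an edge $([u],[v])$ iff for some conjunct, $u$ occurs in a red occurrence and $v$ occurs in a blue occurrence of that conjunct. $\eta$ is suitable iff (a) every conjunct contains exactly one red occurrence; (b) for all $u,v$ occurring in two different blue occurrences, there is no path between $u$ and $v$ in $G_T$; (c) $G_\eta$ is acyclic. $\deg_T(\eta)$ is the number of uncolored occurrences, and the degree of $T$ is the minimum of $\deg_T(\eta)$ over all suitable colorings $\eta$. -}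

module Defs where

open import Data.Nat using (ℕ; _≤_; _*_; _∸_)
open import Data.Nat.DivMod using (_/_)
open import Data.Integer using (ℤ; +_; -_)
open import Data.Fin using (Fin; _≟_; _<?_)
open import Data.List using (List; []; _∷_; _++_; [_]; map; length; lookup; allFin; filter)
open import Data.Nat.ListAction using (sum)
open import Data.Bool using (if_then_else_)
open import Data.Sum using (_⊎_; inj₁; inj₂)
open import Data.Product using (Σ; ∃; _×_; _,_)
open import Relation.Nullary using (¬_; does)
open import Relation.Binary.PropositionalEquality using (_≡_; _≢_)
open import Relation.Binary.Construct.Closure.ReflexiveTransitive using (Star)
open import Relation.Binary.Construct.Closure.Transitive using (TransClosure)

-- Templates over function symbols F = Fin nF and variables D = Fin nD

data Rel▷ : Set where
  ≥▷ >▷ : Rel▷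

-- atom  Σ_f (α_f f(x) + β_f f(x')) + Σ_d γ_d d ▷ 0
record Atom (nD nF : ℕ) : Set where
  constructor atom
  field
    α   : Fin nF → ℤ
    β   : Fin nF → ℤ
    γ   : Fin nD → ℤ
    rel : Rel▷
open Atom public

-- CNF: a list of conjuncts, each a list (disjunction) of atom occurrences
Template : ℕ → ℕ → Set
Template nD nF = List (List (Atom nD nF))

Node : ℕ → ℕ → Set
Node nD nF = Fin nD ⊎ Fin nF

OccursIn : ∀ {nD nF} → Node nD nF → Atom nD nF → Set
OccursIn (inj₁ d) a = γ a d ≢ + 0
OccursIn (inj₂ f) a = (α a f ≢ + 0) ⊎ (β a f ≢ + 0)

module _ {nD nF : ℕ} (T : Template nD nF) where

  Conjunct : Set
  Conjunct = Fin (length T)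

  -- atom occurrences (distinguished by position)
  Occ : Set
  Occ = Σ Conjunct (λ i → Fin (length (lookup T i)))

  atomAt : Occ → Atom nD nF
  atomAt (i , j) = lookup (lookup T i) j

  Edge : Node nD nF → Node nD nF → Set
  Edge u v = ∃ λ (o : Occ) → OccursIn u (atomAt o) × OccursIn v (atomAt o)

  Path : Node nD nF → Node nD nF → Set
  Path = Star Edge

data Color : Set where
  white red blue : Color

isWhite : Color → Data.Bool.Bool
isWhite white = Data.Bool.true
isWhite red   = Data.Bool.false
isWhite blue  = Data.Bool.false

module _ {nD nF : ℕ} (T : Template nD nF) where

  Coloring : Set
  Coloring = Occ T → Color

  module _ (η : Coloring) where

    OneRedPerConjunct : Set
    OneRedPerConjunct = ∀ (i : Conjunct T) →
      ∃ λ j → η (i , j) ≡ red × (∀ j′ → η (i , j′) ≡ red → j′ ≡ j)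

    BlueSeparated : Set
    BlueSeparated = ∀ (o₁ o₂ : Occ T) → o₁ ≢ o₂ → η o₁ ≡ blue → η o₂ ≡ blue →
      ∀ u v → OccursIn u (atomAt T o₁) → OccursIn v (atomAt T o₂) → ¬ Path T u v

    -- edge ([u],[v]) of G_η, expressed on representatives u, v:
    -- some u′ ∈ [u], v′ ∈ [v] with u′ in a red and v′ in a blue occurrence
    -- of the same conjunct
    ColEdge : Node nD nF → Node nD nF → Set
    ColEdge u v = ∃ λ u′ → ∃ λ v′ → Path T u u′ × Path T v v′ ×
      ∃ λ (i : Conjunct T) → ∃ λ j₁ → ∃ λ j₂ →
        η (i , j₁) ≡ red × η (i , j₂) ≡ blue ×
        OccursIn u′ (atomAt T (i , j₁)) × OccursIn v′ (atomAt T (i , j₂))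

    Acyclic : Set
    Acyclic = ∀ u → ¬ TransClosure ColEdge u u

    Suitable : Set
    Suitable = OneRedPerConjunct × BlueSeparated × Acyclic

    -- deg_T(η) = number of uncolored occurrences
    deg : ℕ
    deg = sum (map (λ i → length (filter (λ j → isWhiteDec (η (i , j)))
                                        (allFin (length (lookup T i)))))
                   (allFin (length T)))
      where
        open import Relation.Nullary.Decidable using (yes; no)
        open import Relation.Unary using (Decidable)
        isWhiteDec : Decidable (λ c → isWhite c ≡ Data.Bool.true)
        isWhiteDec c = isWhite c Data.Bool.≟ Data.Bool.true

  HasDegree : ℕ → Set
  HasDegree n = (∃ λ η → Suitable η × deg η ≡ n)
              × (∀ η → Suitable η → n ≤ deg η)

-- The k-phase ranking function template (D = {δ_i}, F = {f_i}, i ∈ Fin k)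

module _ {k : ℕ} where

  e : Fin k → Fin k → ℤ
  e i j = if does (i ≟ j) then + 1 else + 0

  zero′ : Fin k → ℤ
  zero′ _ = + 0

  δpos : Fin k → Atom k k
  δpos i = atom zero′ zero′ (e i) >▷

  fpos : Fin k → Atom k k
  fpos i = atom (e i) zero′ zero′ >▷

  -- f_i(x') < f_i(x) - δ_i,  i.e.  f_i(x) - f_i(x') - δ_i > 0
  fdec : Fin k → Atom k k
  fdec i = atom (e i) (λ j → - e i j) (λ j → - e i j) >▷

  decConj : Fin k → List (Atom k k)
  decConj i = fdec i ∷ map fpos (filter (λ j → j <? i) (allFin k))

kPhase : (k : ℕ) → Template k k
kPhase k = map (λ i → [ δpos i ]) (allFin k)
        ++ [ map fpos (allFin k) ]
        ++ map decConj (allFin k)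

module Submission where

-- Every atom of kPhase k mentions only δ_c and f_c for one index c, and
-- f_c(x) - f_c(x') - δ_c > 0 mentions both, so the components of G_T are
-- the fibres of the labelling δ_c, f_c ↦ c.  After facts on lists,
-- triangular numbers and cycles in finite relations, two general facts
-- about templates are proved: with one red atom per conjunct,
-- deg + #conjuncts + #blue = #occurrences (occurrence-count); and if the
-- components are the fibres of a labelling into Fin (suc m), a suitable
-- colouring has at most m blue atoms (blue-bound), since by (b) blue atoms
-- lie in distinct components and, were all components hit, (a) would give
-- every component a predecessor in G_η and hence a cycle, against (c).
-- kPhase k has 2k+1 conjuncts and 3k + k(k-1)/2 atoms, giving the lower
-- bound; colouring every first atom red and the other k-1 atoms of
-- ⋁ f_i(x) > 0 blue is suitable and attains it.

open import Defs
open import Data.Nat as ℕ using (ℕ; zero; suc; pred; _+_; _*_; _∸_; _≤_; _<′_)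
open import Data.Nat.Properties
  using (+-suc; +-identityʳ; +-assoc; +-cancelˡ-≤; +-monoʳ-≤; *-distribʳ-+; ≤-trans; ≤-antisym; m≤m+n; m≤n+m; ≮⇒≥; n<1+n; <⇒<′; module ≤-Reasoning)
open import Data.Nat.DivMod using (_/_; m*n/n≡m)
open import Data.Nat.ListAction using (sum)
open import Data.Nat.ListAction.Properties using (sum-++)
open import Data.Nat.Tactic.RingSolver using (solve-∀)
open import Data.Integer using (0ℤ; -_)
open import Data.Fin using (Fin; zero; suc; toℕ; _≟_; _<?_; punchOut)
open import Data.Fin.Properties using (toℕ-injective; <⇒≢; pigeonhole; punchOut-injective; all?; ¬∀⟶∃¬)
open import Data.List using (List; []; _∷_; _++_; [_]; length; lookup; map; filter; concat; tabulate; allFin; upTo; applyUpTo)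
open import Data.List.Properties
  using (length-map; length-++; length-tabulate; map-tabulate; tabulate-lookup; map-cong; map-∘; map-++; upTo-∷ʳ; filter-none; filter-all)
open import Data.List.Relation.Unary.Any as Any using (here; there; any?)
open import Data.List.Relation.Unary.Any.Properties using (lookup-index)
open import Data.List.Relation.Unary.All as All using (All; []; _∷_)
open import Data.List.Relation.Unary.All.Properties using (++⁺; map⁺; tabulate⁺)
import Data.List.Relation.Unary.AllPairs as AllPairs
import Data.List.Relation.Unary.AllPairs.Properties as AllPairs
open import Data.List.Relation.Unary.Unique.Propositional using (Unique; []; _∷_)
import Data.List.Relation.Unary.Unique.Propositional.Properties as Unique
open import Data.List.Relation.Binary.Disjoint.Propositional using (Disjoint)
open import Data.List.Membership.Propositional using (_∈_; _∉_)
open import Data.List.Membership.Propositional.Properties using (∈-lookup; ∈-allFin; ∈-map⁺; ∈-map⁻; ∈-++⁺ʳ; ∈-concat⁻′; ∈-filter⁻)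
open import Data.Bool using (true; false)
import Data.Bool as Bool
open import Data.Sum using (inj₁; inj₂)
open import Data.Product using (Σ; ∃; _×_; _,_; proj₁; proj₂)
open import Data.Empty using (⊥-elim)
open import Function using (_∘_; id)
open import Relation.Nullary using (Dec; yes; no; does)
open import Relation.Unary using (Decidable)
open import Relation.Binary.Core using (Rel)
open import Relation.Binary.PropositionalEquality hiding ([_])
open import Relation.Binary.Construct.Closure.ReflexiveTransitive using (ε; _◅_)
open import Relation.Binary.Construct.Closure.Transitive as TC using (TransClosure; _∷_)

_≟ᶜ_ : (c d : Color) → Dec (c ≡ d)
white ≟ᶜ white = yes refl
white ≟ᶜ red   = no λ ()
white ≟ᶜ blue  = no λ ()
red   ≟ᶜ white = no λ ()
red   ≟ᶜ red   = yes refl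
red   ≟ᶜ blue  = no λ ()
blue  ≟ᶜ white = no λ ()
blue  ≟ᶜ red   = no λ ()
blue  ≟ᶜ blue  = yes refl

white? : Decidable (λ c → isWhite c ≡ true)
white? c = isWhite c Bool.≟ true

module ColourCount {A : Set} (f : A → Color) where

  whites reds blues : List A → ℕ
  whites xs = length (filter (white? ∘ f) xs)
  reds   xs = length (filter (λ x → f x ≟ᶜ red) xs)
  blues  xs = length (filter (λ x → f x ≟ᶜ blue) xs)

  colour-partition : ∀ xs → length xs ≡ whites xs + reds xs + blues xs
  colour-partition [] = refl
  colour-partition (x ∷ xs) with f x | colour-partition xs
  ... | white | ih = cong suc ih
  ... | red   | ih = trans (cong suc ih) (cong (_+ blues xs) (sym (+-suc (whites xs) (reds xs))))
  ... | blue  | ih = trans (cong suc ih) (sym (+-suc (whites xs + reds xs) (blues xs)))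

filter-singleton : ∀ {A : Set} {P : A → Set} (P? : Decidable P) {x} {xs} →
  Unique xs → x ∈ xs → P x → (∀ {y} → P y → y ≡ x) → length (filter P? xs) ≡ 1
filter-singleton {P = P} P? {x} {y ∷ ys} (y∉ys ∷ uniq) x∈ Px only with P? y
... | yes Py = cong (suc ∘ length)
                 (filter-none P? (All.map (λ y≢z Pz → y≢z (trans (only Py) (sym (only Pz)))) y∉ys))
... | no ¬Py with x∈
...   | here x≡y    = ⊥-elim (¬Py (subst P x≡y Px))
...   | there x∈ys = filter-singleton P? uniq x∈ys Px only

lookup-injective : ∀ {A : Set} {xs : List A} → Unique xs → ∀ {i j} → lookup xs i ≡ lookup xs j → i ≡ j
lookup-injective {xs = _ ∷ _} _          {zero}  {zero}  _  = refl
lookup-injective {xs = _ ∷ _} (x∉ ∷ _)   {zero}  {suc j} eq = ⊥-elim (All.lookup x∉ (∈-lookup j) eq)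
lookup-injective {xs = _ ∷ _} (x∉ ∷ _)   {suc i} {zero}  eq = ⊥-elim (All.lookup x∉ (∈-lookup i) (sym eq))
lookup-injective {xs = _ ∷ _} (_ ∷ uniq) {suc i} {suc j} eq = cong suc (lookup-injective uniq eq)

∉⇒≢lookup : ∀ {A : Set} {c : A} {xs} → c ∉ xs → ∀ i → c ≢ lookup xs i
∉⇒≢lookup c∉xs i c≡ = c∉xs (subst (_∈ _) (sym c≡) (∈-lookup i))

unique-missing-length : ∀ {m} {xs : List (Fin (suc m))} {c} → Unique xs → c ∉ xs → length xs ≤ m
unique-missing-length {m} {xs} uniq c∉xs with m ℕ.<? length xs
... | no m≮len = ≮⇒≥ m≮len
... | yes m<len with pigeonhole m<len (λ i → punchOut (∉⇒≢lookup c∉xs i))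
...   | i , j , i<j , same =
  ⊥-elim (<⇒≢ i<j (lookup-injective uniq
                      (punchOut-injective (∉⇒≢lookup c∉xs i) (∉⇒≢lookup c∉xs j) same)))

map-unique : ∀ {A B : Set} {P : A → Set} (f : A → B) →
  (∀ {x y} → P x → P y → x ≢ y → f x ≢ f y) → ∀ {xs} → All P xs → Unique xs → Unique (map f xs)
map-unique f sep []         []           = []
map-unique f sep (px ∷ pxs) (x∉xs ∷ uniq) =
  map⁺ (All.zipWith (λ (x≢y , py) → sep px py x≢y) (x∉xs , pxs)) ∷ map-unique f sep pxs uniq

lookup-tabulate-toℕ : ∀ {A : Set} {n} (f : Fin n → A) (j : Fin (length (tabulate f))) →
  ∃ λ c → toℕ c ≡ toℕ j × lookup (tabulate f) j ≡ f c
lookup-tabulate-toℕ {n = suc n} f zero    = zero , refl , refl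
lookup-tabulate-toℕ {n = suc n} f (suc j) =
  let c , same , at = lookup-tabulate-toℕ (f ∘ suc) j in suc c , cong suc same , at

map-lookup : ∀ {A B : Set} (f : A → B) (xs : List A) → map (f ∘ lookup xs) (allFin (length xs)) ≡ map f xs
map-lookup f xs = begin
    map (f ∘ lookup xs) (tabulate id) ≡⟨ map-tabulate id (f ∘ lookup xs) ⟩
    tabulate (f ∘ lookup xs)          ≡⟨ map-tabulate (lookup xs) f ⟨
    map f (tabulate (lookup xs))      ≡⟨ cong (map f) (tabulate-lookup xs) ⟩
    map f xs                          ∎
  where open ≡-Reasoning

sum-ones : ∀ {A : Set} (xs : List A) → sum (map (λ _ → 1) xs) ≡ length xs
sum-ones []       = refl
sum-ones (_ ∷ xs) = cong suc (sum-ones xs)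

sum-map-suc : ∀ {A : Set} (f : A → ℕ) xs → sum (map (suc ∘ f) xs) ≡ length xs + sum (map f xs)
sum-map-suc f []       = refl
sum-map-suc f (x ∷ xs) = cong suc (trans (cong (f x +_) (sum-map-suc f xs)) (regroup (f x) (length xs) (sum (map f xs))))
  where
  regroup : ∀ a l s → a + (l + s) ≡ l + (a + s)
  regroup = solve-∀

sum-split : ∀ {A : Set} (f g : A → ℕ) xs →
  sum (map (λ x → f x + 1 + g x) xs) ≡ sum (map f xs) + length xs + sum (map g xs)
sum-split f g []       = refl
sum-split f g (x ∷ xs) = trans (cong (f x + 1 + g x +_) (sum-split f g xs)) (regroup (f x) (g x) _ _ _)
  where
  regroup : ∀ a b s l t → a + 1 + b + (s + l + t) ≡ a + s + suc l + (b + t)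
  regroup = solve-∀

≤-sum : ∀ {A : Set} (f : A → ℕ) {x xs} → x ∈ xs → f x ≤ sum (map f xs)
≤-sum f               (here refl) = m≤m+n _ _
≤-sum f {xs = y ∷ ys} (there x∈)  = ≤-trans (≤-sum f x∈) (m≤n+m _ (f y))

module _ {d n b m s : ℕ} (balance : d + n + b ≡ n + (m + s)) where
  open ≤-Reasoning

  balance-lower : b ≤ m → s ≤ d
  balance-lower b≤m = +-cancelˡ-≤ (n + m) s d (begin
    n + m + s   ≡⟨ +-assoc n m s ⟩
    n + (m + s) ≡⟨ balance ⟨
    d + n + b   ≤⟨ +-monoʳ-≤ (d + n) b≤m ⟩
    d + n + m   ≡⟨ regroup d n m ⟩
    n + m + d   ∎)
    where
    regroup : ∀ d n m → d + n + m ≡ n + m + d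
    regroup = solve-∀

  balance-upper : m ≤ b → d ≤ s
  balance-upper m≤b = +-cancelˡ-≤ (n + m) d s (begin
    n + m + d   ≡⟨ regroup d n m ⟩
    d + n + m   ≤⟨ +-monoʳ-≤ (d + n) m≤b ⟩
    d + n + b   ≡⟨ balance ⟩
    n + (m + s) ≡⟨ +-assoc n m s ⟨
    n + m + s   ∎)
    where
    regroup : ∀ d n m → n + m + d ≡ d + n + m
    regroup = solve-∀

none-below-zero : ∀ {n m} (f : Fin n → Fin (suc m)) → length (filter (_<? zero {m}) (tabulate f)) ≡ 0
none-below-zero {zero}  f = refl
none-below-zero {suc n} f = none-below-zero (f ∘ suc)

below-suc : ∀ {n m} (f : Fin n → Fin m) (i : Fin m) →
  length (filter (_<? suc i) (tabulate (λ x → suc (f x)))) ≡ length (filter (_<? i) (tabulate f))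
below-suc {zero}  f i = refl
below-suc {suc n} f i with does (f zero <? i)
... | true  = cong suc (below-suc (λ x → f (suc x)) i)
... | false = below-suc (λ x → f (suc x)) i

count-below : ∀ {m} (i : Fin m) → length (filter (_<? i) (allFin m)) ≡ toℕ i
count-below {suc m} zero = none-below-zero {n = suc m} id
count-below {suc m} (suc i) = cong suc (trans (below-suc id i) (count-below i))

triangle : ℕ → ℕ
triangle n = sum (upTo n)

tabulate-toℕ : ∀ {A : Set} n (g : ℕ → A) → tabulate {n = n} (λ i → g (toℕ i)) ≡ applyUpTo g n
tabulate-toℕ zero    g = refl
tabulate-toℕ (suc n) g = cong (g 0 ∷_) (tabulate-toℕ n (λ i → g (suc i)))

sum-toℕ : ∀ n → sum (map toℕ (allFin n)) ≡ triangle n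
sum-toℕ n = cong sum (trans (map-tabulate id toℕ) (tabulate-toℕ n id))

triangle-suc : ∀ n → triangle (suc n) ≡ triangle n + n
triangle-suc n = trans (cong sum (sym (upTo-∷ʳ n)))
                       (trans (sum-++ (upTo n) [ n ]) (cong (triangle n +_) (+-identityʳ n)))

triangle-double : ∀ n → triangle n * 2 ≡ n * (n ∸ 1)
triangle-double zero          = refl
triangle-double (suc zero)    = refl
triangle-double (suc (suc n)) = begin
    triangle (2 + n) * 2          ≡⟨ cong (_* 2) (triangle-suc (suc n)) ⟩
    (triangle (1 + n) + (1 + n)) * 2 ≡⟨ *-distribʳ-+ 2 (triangle (1 + n)) (1 + n) ⟩
    triangle (1 + n) * 2 + (1 + n) * 2 ≡⟨ cong (_+ (1 + n) * 2) (triangle-double (suc n)) ⟩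
    (1 + n) * n + (1 + n) * 2      ≡⟨ regroup n ⟩
    (2 + n) * (1 + n)              ∎
  where
  open ≡-Reasoning
  regroup : ∀ n → (1 + n) * n + (1 + n) * 2 ≡ (2 + n) * (1 + n)
  regroup = solve-∀

half-pronic : ∀ n → n * (n ∸ 1) / 2 ≡ triangle n
half-pronic n = trans (cong (_/ 2) (sym (triangle-double n))) (m*n/n≡m (triangle n) 2)

-- If every member of a finite family rep has an R-predecessor within the
-- family, then walking backwards along predecessors must revisit a member,
-- which closes a cycle.
module Predecessors {A : Set} {ℓ} (R : Rel A ℓ) {m : ℕ} (rep : Fin (suc m) → A)
                    (predecessor : ∀ c → ∃ λ p → R (rep p) (rep c)) where

  walk : ℕ → Fin (suc m)
  walk zero    = zero
  walk (suc n) = proj₁ (predecessor (walk n))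

  descend : ∀ {a b} → a <′ b → TransClosure R (rep (walk b)) (rep (walk a))
  descend {a} ℕ.<′-base         = TC.[ proj₂ (predecessor (walk a)) ]
  descend (ℕ.<′-step {b} a<′b) = proj₂ (predecessor (walk b)) ∷ descend a<′b

  cycle : ∃ λ c → TransClosure R (rep c) (rep c)
  cycle with pigeonhole (n<1+n (suc m)) (walk ∘ toℕ)
  ... | i , j , i<j , same =
    walk (toℕ i) , subst (λ c → TransClosure R (rep c) (rep (walk (toℕ i)))) (sym same) (descend (<⇒<′ i<j))

module _ {nD nF} (T : Template nD nF) (η : Coloring T) where

  rowCount : ∀ {P : Color → Set} → Decidable P → Conjunct T → ℕ
  rowCount P? i = length (filter (λ j → P? (η (i , j))) (allFin (length (lookup T i))))

  blueCount : ℕ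
  blueCount = sum (map (rowCount (_≟ᶜ blue)) (allFin (length T)))

  -- With one red atom per conjunct every occurrence is white, blue, or
  -- the red one of its conjunct.
  occurrence-count : OneRedPerConjunct T η → deg T η + length T + blueCount ≡ sum (map length T)
  occurrence-count one-red = sym (begin
      sum (map length T)
    ≡⟨ cong sum (map-lookup length T) ⟨
      sum (map (length ∘ lookup T) (allFin (length T)))
    ≡⟨ cong sum (map-cong row-split (allFin (length T))) ⟩
      sum (map (λ i → rowCount white? i + 1 + rowCount (_≟ᶜ blue) i) (allFin (length T)))
    ≡⟨ sum-split (rowCount white?) (rowCount (_≟ᶜ blue)) (allFin (length T)) ⟩
      deg T η + length (allFin (length T)) + blueCount
    ≡⟨ cong (λ n → deg T η + n + blueCount) (length-tabulate id) ⟩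
      deg T η + length T + blueCount
    ∎)
    where
    open ≡-Reasoning

    one-red-in-row : ∀ i → ColourCount.reds (λ j → η (i , j)) (allFin (length (lookup T i))) ≡ 1
    one-red-in-row i = let j , red-j , only = one-red i in
      filter-singleton (λ j → η (i , j) ≟ᶜ red) (Unique.allFin⁺ _) (∈-allFin j) red-j (only _)

    row-split : ∀ i → length (lookup T i) ≡ rowCount white? i + 1 + rowCount (_≟ᶜ blue) i
    row-split i = begin
        length (lookup T i)
      ≡⟨ length-tabulate id ⟨
        length (allFin (length (lookup T i)))
      ≡⟨ colour-partition positions ⟩
        whites positions + reds positions + blues positions
      ≡⟨ cong (λ r → whites positions + r + blues positions) (one-red-in-row i) ⟩
        rowCount white? i + 1 + rowCount (_≟ᶜ blue) i
      ∎
      where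
      open ColourCount (λ j → η (i , j))
      positions = allFin (length (lookup T i))

module ComponentLabelling {nD nF m : ℕ} (T : Template nD nF)
  (label       : Node nD nF → Fin (suc m))
  (edge-label  : ∀ {u v} → Edge T u v → label u ≡ label v)
  (fibre-path  : ∀ {u v} → label u ≡ label v → Path T u v)
  (mentioned   : (o : Occ T) → ∃ λ u → OccursIn u (atomAt T o)) where

  path-label : ∀ {u v} → Path T u v → label u ≡ label v
  path-label ε       = refl
  path-label (e ◅ p) = trans (edge-label e) (path-label p)

  node : Occ T → Node nD nF
  node o = proj₁ (mentioned o)

  node-occurs : ∀ o → OccursIn (node o) (atomAt T o)
  node-occurs o = proj₂ (mentioned o)

  atomLabel : Occ T → Fin (suc m)
  atomLabel o = label (node o)

  occurrenceIn : (i : Conjunct T) → Fin (length (lookup T i)) → Occ T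
  occurrenceIn i j = i , j

  module _ (η : Coloring T) where

    bluePositions : (i : Conjunct T) → List (Fin (length (lookup T i)))
    bluePositions i = filter (λ j → η (i , j) ≟ᶜ blue) (allFin (length (lookup T i)))

    blueRow : Conjunct T → List (Occ T)
    blueRow i = map (occurrenceIn i) (bluePositions i)

    blueOccs : List (Occ T)
    blueOccs = concat (map blueRow (allFin (length T)))

    length-blueOccs : length blueOccs ≡ blueCount T η
    length-blueOccs = rows (allFin (length T))
      where
      row-length : ∀ i → length (blueRow i) ≡ rowCount T η (_≟ᶜ blue) i
      row-length i = length-map (occurrenceIn i) (bluePositions i)

      rows : ∀ is → length (concat (map blueRow is)) ≡ sum (map (rowCount T η (_≟ᶜ blue)) is)
      rows []       = refl
      rows (i ∷ is) = trans (length-++ (blueRow i)) (cong₂ _+_ (row-length i) (rows is))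

    blueOccs-blue : ∀ {o} → o ∈ blueOccs → η o ≡ blue
    blueOccs-blue o∈ with ∈-concat⁻′ (map blueRow (allFin (length T))) o∈
    ... | _ , o∈row , row∈ with ∈-map⁻ blueRow row∈
    ... | i , _ , refl with ∈-map⁻ (occurrenceIn i) o∈row
    ... | _ , j∈ , refl =
      proj₂ (∈-filter⁻ (λ j → η (i , j) ≟ᶜ blue) {xs = allFin (length (lookup T i))} j∈)

    blueOccs-unique : Unique blueOccs
    blueOccs-unique = Unique.concat⁺ (map⁺ (All.universal row-unique _))
                                      (AllPairs.map⁺ (AllPairs.map rows-disjoint (Unique.allFin⁺ _)))
      where
      row-unique : ∀ i → Unique (blueRow i)
      row-unique i = Unique.map⁺ (λ { refl → refl }) (Unique.filter⁺ _ (Unique.allFin⁺ _))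

      rows-disjoint : ∀ {i i′} → i ≢ i′ → Disjoint (blueRow i) (blueRow i′)
      rows-disjoint i≢i′ (p , q) with ∈-map⁻ _ p | ∈-map⁻ _ q
      ... | _ , _ , e₁ | _ , _ , e₂ = i≢i′ (cong proj₁ (trans (sym e₁) e₂))

    blue-labels-distinct : BlueSeparated T η → ∀ {o₁ o₂} → η o₁ ≡ blue → η o₂ ≡ blue →
                           o₁ ≢ o₂ → atomLabel o₁ ≢ atomLabel o₂
    blue-labels-distinct separated b₁ b₂ o₁≢o₂ same =
      separated _ _ o₁≢o₂ b₁ b₂ _ _ (node-occurs _) (node-occurs _) (fibre-path same)

    -- (a): if every component contains a blue occurrence, every component
    -- has a predecessor in G_η, hence G_η has a cycle.
    module EveryLabelBlue (one-red : OneRedPerConjunct T η)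
                          (covered : ∀ c → c ∈ map atomLabel blueOccs) where

      witness : ∀ c → Σ (Occ T) λ o → o ∈ blueOccs × c ≡ atomLabel o
      witness c = ∈-map⁻ atomLabel (covered c)

      rep : Fin (suc m) → Node nD nF
      rep c = node (proj₁ (witness c))

      rep-label : ∀ c → label (rep c) ≡ c
      rep-label c = sym (proj₂ (proj₂ (witness c)))

      predecessor : ∀ c → ∃ λ p → ColEdge T η (rep p) (rep c)
      predecessor c with witness c
      ... | (i , j) , o∈ , _ with one-red i
      ... | j₀ , red₀ , _ =
        atomLabel (i , j₀) , node (i , j₀) , node (i , j) , fibre-path (rep-label _) , ε ,
        i , j₀ , j , red₀ , blueOccs-blue o∈ , node-occurs _ , node-occurs _

      cycle : ∃ λ u → TransClosure (ColEdge T η) u u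
      cycle = let c , c↝c = Predecessors.cycle (ColEdge T η) rep predecessor in rep c , c↝c

    -- Either some component has no blue atom, and the pigeonhole principle
    -- bounds the distinct blue labels by m, or G_η has a cycle.
    blue-bound : Suitable T η → blueCount T η ≤ m
    blue-bound (one-red , separated , acyclic) with all? (λ c → any? (c ≟_) (map atomLabel blueOccs))
    ... | yes covered = ⊥-elim (let u , u↝u = EveryLabelBlue.cycle one-red covered in acyclic u u↝u)
    ... | no uncovered =
      let c , c∉ = ¬∀⟶∃¬ (suc m) _ (λ c → any? (c ≟_) (map atomLabel blueOccs)) uncovered
          labels-unique = map-unique atomLabel (blue-labels-distinct separated)
                                     (All.tabulate blueOccs-blue) blueOccs-unique
      in subst (_≤ m) (trans (length-map atomLabel blueOccs) length-blueOccs)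
               (unique-missing-length labels-unique c∉)

occurrence-of : ∀ {nD nF} (T : Template nD nF) {C a} → C ∈ T → a ∈ C → Σ (Occ T) λ o → atomAt T o ≡ a
occurrence-of (C ∷ T) (here refl)  a∈C = (zero , Any.index a∈C) , sym (lookup-index a∈C)
occurrence-of (_ ∷ T) (there C∈T) a∈C = let (i , j) , at = occurrence-of T C∈T a∈C in (suc i , j) , at

positionColour : ∀ {P : Set} {n} → Dec P → Fin n → Color
positionColour _       zero    = red
positionColour (yes _) (suc _) = blue
positionColour (no _)  (suc _) = white

positionColour-red : ∀ {P : Set} {n} (d : Dec P) (j : Fin n) → positionColour d j ≡ red → toℕ j ≡ 0
positionColour-red _       zero    _  = refl
positionColour-red (yes _) (suc _) ()
positionColour-red (no _)  (suc _) ()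

positionColour-blue : ∀ {P : Set} {n} (d : Dec P) (j : Fin n) → positionColour d j ≡ blue → P × toℕ j ≢ 0
positionColour-blue (yes p) (suc _) _ = p , λ ()
positionColour-blue (no _)  (suc _) ()
positionColour-blue (yes _) zero    ()
positionColour-blue (no _)  zero    ()

positionColour-one-red : ∀ {P : Set} {n} (d : Dec P) → Fin n →
  ∃ λ (j : Fin n) → positionColour d j ≡ red × (∀ j′ → positionColour d j′ ≡ red → j′ ≡ j)
positionColour-one-red {n = suc _} d _ = zero , refl , λ j′ r → toℕ-injective (positionColour-red d j′ r)

positionColour-blues : ∀ {P : Set} {n} (d : Dec P) → P →
  length (filter (λ j → positionColour d j ≟ᶜ blue) (allFin n)) ≡ pred n
positionColour-blues {n = zero}  _       _ = refl
positionColour-blues {n = suc n} (yes p) _ =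
  trans (cong length (filter-all (λ j → positionColour (yes p) j ≟ᶜ blue) (tabulate⁺ {f = later} (λ _ → refl))))
        (length-tabulate later)
  where
  later : Fin n → Fin (suc n)
  later = suc
positionColour-blues {n = suc n} (no ¬p) p = ⊥-elim (¬p p)

e-support : ∀ {n} {i j : Fin n} → e i j ≢ 0ℤ → j ≡ i
e-support {i = i} {j} nz with i ≟ j
... | yes i≡j = sym i≡j
... | no _    = ⊥-elim (nz refl)

neg-e-support : ∀ {n} {i j : Fin n} → - e i j ≢ 0ℤ → j ≡ i
neg-e-support nz = e-support (λ z → nz (cong -_ z))

e-diagonal : ∀ {n} (i : Fin n) → e i i ≢ 0ℤ
e-diagonal i with i ≟ i
... | yes _   = λ ()
... | no i≢i = ⊥-elim (i≢i refl)

neg-e-diagonal : ∀ {n} (i : Fin n) → - e i i ≢ 0ℤ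
neg-e-diagonal i with i ≟ i
... | yes _   = λ ()
... | no i≢i = ⊥-elim (i≢i refl)

module KPhase (m : ℕ) where

  k : ℕ
  k = suc m

  T : Template k k
  T = kPhase k

  label : Node k k → Fin k
  label (inj₁ c) = c
  label (inj₂ c) = c

  Local : Fin k → Atom k k → Set
  Local c a = (∀ u → OccursIn u a → label u ≡ c) × ∃ λ u → OccursIn u a

  δpos-local : ∀ c → Local c (δpos c)
  δpos-local c = only , inj₁ c , e-diagonal c
    where
    only : ∀ u → OccursIn u (δpos c) → label u ≡ c
    only (inj₁ _) nz       = e-support nz
    only (inj₂ _) (inj₁ z) = ⊥-elim (z refl)
    only (inj₂ _) (inj₂ z) = ⊥-elim (z refl)

  fpos-local : ∀ c → Local c (fpos c)
  fpos-local c = only , inj₂ c , inj₁ (e-diagonal c)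
    where
    only : ∀ u → OccursIn u (fpos c) → label u ≡ c
    only (inj₁ _) z         = ⊥-elim (z refl)
    only (inj₂ _) (inj₁ nz) = e-support nz
    only (inj₂ _) (inj₂ z)  = ⊥-elim (z refl)

  fdec-local : ∀ c → Local c (fdec c)
  fdec-local c = only , inj₂ c , inj₁ (e-diagonal c)
    where
    only : ∀ u → OccursIn u (fdec c) → label u ≡ c
    only (inj₁ _) nz        = neg-e-support nz
    only (inj₂ _) (inj₁ nz) = e-support nz
    only (inj₂ _) (inj₂ nz) = neg-e-support nz

  all-local : All (All (λ a → ∃ λ c → Local c a)) T
  all-local = ++⁺ (map⁺ (All.universal (λ c → (c , δpos-local c) ∷ []) (allFin k)))
                  (map⁺ (All.universal (λ c → c , fpos-local c) (allFin k))
                   ∷ map⁺ (All.universal (λ c → (c , fdec-local c) ∷ decConj-tail c) (allFin k)))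
    where
    decConj-tail : ∀ c → All (λ a → ∃ λ d → Local d a) (map fpos (filter (_<? c) (allFin k)))
    decConj-tail c = map⁺ (All.universal (λ d → d , fpos-local d) (filter (_<? c) (allFin k)))

  occ-local : (o : Occ T) → ∃ λ c → Local c (atomAt T o)
  occ-local (i , j) = All.lookup (All.lookup all-local (∈-lookup i)) (∈-lookup j)

  edge-label : ∀ {u v} → Edge T u v → label u ≡ label v
  edge-label (o , u∈ , v∈) = let _ , only , _ = occ-local o in trans (only _ u∈) (sym (only _ v∈))

  δ-f-edge : ∀ c → Edge T (inj₁ c) (inj₂ c)
  δ-f-edge c =
    let decConj∈T = ∈-++⁺ʳ (map (λ c → [ δpos c ]) (allFin k)) (there (∈-map⁺ decConj (∈-allFin c)))
        o , at = occurrence-of T decConj∈T (here refl)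
    in o , subst (OccursIn (inj₁ c)) (sym at) (neg-e-diagonal c)
         , subst (OccursIn (inj₂ c)) (sym at) (inj₁ (e-diagonal c))

  fibre-path : ∀ {u v} → label u ≡ label v → Path T u v
  fibre-path {inj₁ c} {inj₁ _} refl = ε
  fibre-path {inj₁ c} {inj₂ _} refl = δ-f-edge c ◅ ε
  fibre-path {inj₂ c} {inj₁ _} refl = (let o , δ∈ , f∈ = δ-f-edge c in o , f∈ , δ∈) ◅ ε
  fibre-path {inj₂ c} {inj₂ _} refl = ε

  open ComponentLabelling T label edge-label fibre-path (proj₂ ∘ proj₂ ∘ occ-local)

  conjunct-count : length T ≡ k + suc k
  conjunct-count = trans (length-++ (map (λ c → [ δpos c ]) (allFin k)))
    (cong₂ _+_ (trans (length-map _ (allFin k)) (length-tabulate id))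
               (cong suc (trans (length-map _ (allFin k)) (length-tabulate id))))

  length-decConj : ∀ (c : Fin k) → length (decConj c) ≡ suc (toℕ c)
  length-decConj c = cong suc (trans (length-map fpos (filter (_<? c) (allFin k))) (count-below c))

  occurrence-total : sum (map length T) ≡ k + (k + (k + triangle k))
  occurrence-total = begin
      sum (map length T)
    ≡⟨ cong sum (map-++ length (map (λ c → [ δpos c ]) (allFin k)) _) ⟩
      sum (map length (map (λ c → [ δpos c ]) (allFin k)) ++ map length (map fpos (allFin k) ∷ map decConj (allFin k)))
    ≡⟨ sum-++ (map length (map (λ c → [ δpos c ]) (allFin k))) _ ⟩
      sum (map length (map (λ c → [ δpos c ]) (allFin k)))
        + (length (map fpos (allFin k)) + sum (map length (map decConj (allFin k))))
    ≡⟨ cong₂ _+_ δ-rows (cong₂ _+_ (trans (length-map fpos (allFin k)) (length-tabulate id)) dec-rows) ⟩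
      k + (k + (k + triangle k))
    ∎
    where
    open ≡-Reasoning
    δ-rows : sum (map length (map (λ c → [ δpos c ]) (allFin k))) ≡ k
    δ-rows = trans (cong sum (sym (map-∘ {g = length} {f = λ c → [ δpos c ]} (allFin k))))
                   (trans (sum-ones (allFin k)) (length-tabulate id))
    dec-rows : sum (map length (map decConj (allFin k))) ≡ k + triangle k
    dec-rows = begin
        sum (map length (map decConj (allFin k)))  ≡⟨ cong sum (map-∘ {g = length} {f = decConj} (allFin k)) ⟨
        sum (map (length ∘ decConj) (allFin k))    ≡⟨ cong sum (map-cong length-decConj (allFin k)) ⟩
        sum (map (suc ∘ toℕ) (allFin k))           ≡⟨ sum-map-suc toℕ (allFin k) ⟩
        length (allFin k) + sum (map toℕ (allFin k)) ≡⟨ cong₂ _+_ (length-tabulate id) (sum-toℕ k) ⟩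
        k + triangle k                             ∎

  colour-balance : ∀ η → OneRedPerConjunct T η → deg T η + length T + blueCount T η ≡ length T + (m + triangle k)
  colour-balance η one-red = trans (occurrence-count T η one-red)
    (trans occurrence-total (trans (regroup m (triangle k)) (cong (_+ (m + triangle k)) (sym conjunct-count))))
    where
    regroup : ∀ m s → suc m + (suc m + (suc m + s)) ≡ suc m + suc (suc m) + (m + s)
    regroup = solve-∀

  degree-lower-bound : ∀ η → Suitable T η → triangle k ≤ deg T η
  degree-lower-bound η suitable = balance-lower (colour-balance η (proj₁ suitable)) (blue-bound η suitable)

  disjunction∈T : map fpos (allFin k) ∈ T
  disjunction∈T = ∈-++⁺ʳ (map (λ c → [ δpos c ]) (allFin k)) (here refl)

  iD : Conjunct T
  iD = Any.index disjunction∈T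

  disjunction-length : length (lookup T iD) ≡ suc m
  disjunction-length = trans (cong length (sym (lookup-index disjunction∈T)))
                             (trans (length-map fpos (allFin k)) (length-tabulate id))

  disjunction-label : ∀ j {u} → OccursIn u (atomAt T (iD , j)) → toℕ (label u) ≡ toℕ j
  disjunction-label j {u} u∈ =
    let c , same , at = at-position (lookup T iD) (trans (sym (lookup-index disjunction∈T)) (map-tabulate id fpos)) j
    in trans (cong toℕ (proj₁ (fpos-local c) u (subst (OccursIn u) at u∈))) same
    where
    at-position : (C : List (Atom k k)) → C ≡ tabulate fpos → (j : Fin (length C)) →
                  ∃ λ c → toℕ c ≡ toℕ j × lookup C j ≡ fpos c
    at-position _ refl = lookup-tabulate-toℕ fpos

  η₀ : Coloring T
  η₀ (i , j) = positionColour (i ≟ iD) j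

  first-positions : All (λ C → Fin (length C)) T
  first-positions = ++⁺ (map⁺ (All.universal (λ _ → zero) (allFin k)))
                        (zero ∷ map⁺ (All.universal (λ _ → zero) (allFin k)))

  η₀-one-red : OneRedPerConjunct T η₀
  η₀-one-red i = positionColour-one-red (i ≟ iD) (All.lookup first-positions (∈-lookup i))

  η₀-separated : BlueSeparated T η₀
  η₀-separated (i₁ , j₁) (i₂ , j₂) o₁≢o₂ b₁ b₂ u v u∈ v∈ u↝v
    with positionColour-blue (i₁ ≟ iD) j₁ b₁ | positionColour-blue (i₂ ≟ iD) j₂ b₂
  ... | refl , _ | refl , _ = o₁≢o₂ (cong (iD ,_) (toℕ-injective (begin
      toℕ j₁          ≡⟨ disjunction-label j₁ u∈ ⟨
      toℕ (label u)   ≡⟨ cong toℕ (path-label u↝v) ⟩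
      toℕ (label v)   ≡⟨ disjunction-label j₂ v∈ ⟩
      toℕ j₂          ∎)))
    where open ≡-Reasoning

  η₀-edge : ∀ {x y} → ColEdge T η₀ x y → toℕ (label x) ≡ 0 × toℕ (label y) ≢ 0
  η₀-edge (u , v , x↝u , y↝v , i , j₁ , j₂ , r , b , u∈ , v∈) with positionColour-blue (i ≟ iD) j₂ b
  ... | refl , j₂≢0 =
    trans (cong toℕ (path-label x↝u)) (trans (disjunction-label j₁ u∈) (positionColour-red _ j₁ r)) ,
    λ y≡0 → j₂≢0 (trans (sym (disjunction-label j₂ v∈)) (trans (cong toℕ (sym (path-label y↝v))) y≡0))

  η₀-closure : ∀ {x y} → TransClosure (ColEdge T η₀) x y → toℕ (label x) ≡ 0 × toℕ (label y) ≢ 0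
  η₀-closure TC.[ e ] = η₀-edge e
  η₀-closure (e ∷ es) = proj₁ (η₀-edge e) , proj₂ (η₀-closure es)

  η₀-suitable : Suitable T η₀
  η₀-suitable = η₀-one-red , η₀-separated , λ u u↝u → let from₀ , to≢0 = η₀-closure u↝u in to≢0 from₀

  η₀-blues : m ≤ blueCount T η₀
  η₀-blues = begin
      m                                 ≡⟨ cong pred disjunction-length ⟨
      pred (length (lookup T iD))       ≡⟨ positionColour-blues {n = length (lookup T iD)} (iD ≟ iD) refl ⟨
      rowCount T η₀ (_≟ᶜ blue) iD       ≤⟨ ≤-sum (rowCount T η₀ (_≟ᶜ blue)) (∈-allFin iD) ⟩
      blueCount T η₀                    ∎
    where open ≤-Reasoning

  η₀-degree : deg T η₀ ≡ triangle k
  η₀-degree = ≤-antisym (balance-upper (colour-balance η₀ η₀-one-red) η₀-blues)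
                        (degree-lower-bound η₀ η₀-suitable)

lemma6p24 : (k : ℕ) → 1 ≤ k → HasDegree (kPhase k) ((k * (k ∸ 1)) / 2)
lemma6p24 (suc m) _ =
  subst (HasDegree (kPhase (suc m))) (sym (half-pronic (suc m)))
        ((η₀ , η₀-suitable , η₀-degree) , degree-lower-bound)
  where open KPhase m
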